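{- For all integers $n \geq 1$ and $q \geq 0$, \[ (q+1)^n - (n+1)q^n \leq A(n,q) \leq (q+1)^n. \]
   Context: $A(n,q)$ is the Eulerian number (number of permutations of $\{1,\dots,n\}$ with exactly $q$ ascents), with the convention $A(n,q)=0$ if $q \geq n$. -}

module Defs where

open import Data.Nat using (ℕ; zero; suc; _<ᵇ_; _+_)
open import Data.Bool using (Bool; true; false; if_then_else_)
open import Data.List using (List; []; _∷_; concatMap; map; length; filterᵇ; upTo)
open import Data.Nat using (_≡ᵇ_)

insertions : ℕ → List ℕ → List (List ℕ)
insertions x [] = (x ∷ []) ∷ []
insertions x (y ∷ ys) = (x ∷ y ∷ ys) ∷ map (y ∷_) (insertions x ys)

-- all permutations (as lists) of a list of distinct elements;
-- each permutation appears exactly once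
perms : List ℕ → List (List ℕ)
perms [] = [] ∷ []
perms (x ∷ xs) = concatMap (insertions x) (perms xs)

permutationsOf : ℕ → List (List ℕ)
permutationsOf n = perms (map suc (upTo n))

ascents : List ℕ → ℕ
ascents [] = 0
ascents (x ∷ []) = 0
ascents (x ∷ y ∷ ys) = (if x <ᵇ y then 1 else 0) + ascents (y ∷ ys)

-- Eulerian number A(n,q): number of permutations of {1,…,n} with exactly q ascents
-- (automatically 0 when q ≥ n, for n ≥ 1)
eulerian : ℕ → ℕ → ℕ
eulerian n q = length (filterᵇ (λ w → ascents w ≡ᵇ q) (permutationsOf n))

{-# OPTIONS --safe #-}
-- Inserting the smallest letter into a permutation of the others either keeps or raises the
-- number of ascents, which gives the recurrence A(n+1,k+1) = (k+2) A(n,k+1) + (n-k) A(n,k).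
-- From it and Pascal's rule follows Worpitzky's identity (q+1)^n = Σ_k A(n,k) C(q+n-k, n).
-- Its term k = q is A(n,q), whence the upper bound. For the lower bound compare the identity
-- at q with the one at q-1 term by term: C(M+1,n) ≤ (n+1) C(M,n) when n ≤ M, the term k = q
-- contributes A(n,q), and the terms k > q vanish.
module Submission where

open import Data.Bool using (Bool; true; false; if_then_else_)
open import Data.Fin using (toℕ; fromℕ<)
import Data.Fin as Fin
open import Data.Fin.Properties using (toℕ<n; toℕ-inject₁; toℕ-fromℕ; toℕ-fromℕ<)
open import Data.List using (List; []; _∷_; _++_; map; concatMap; length; filterᵇ; upTo)
open import Data.List.Properties using (map-++; map-cong; length-map; length-upTo)
open import Data.List.Relation.Unary.All as All using (All; []; _∷_)
open import Data.List.Relation.Unary.All.Properties using (concat⁺; map⁺)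
open import Data.List.Relation.Unary.AllPairs using (AllPairs; []; _∷_)
import Data.List.Relation.Unary.AllPairs.Properties as AllPairs
open import Data.Nat
open import Data.Nat.Combinatorics
  using (_C_; nCk+nC[k+1]≡[n+1]C[k+1]; nCn≡1; nC1≡n; k>n⇒nCk≡0)
import Data.Nat.ListAction as List
open import Data.Nat.ListAction.Properties using (sum-++)
open import Data.Nat.Properties
open import Data.Nat.Tactic.RingSolver using (solve-∀)
open import Data.Product using (_×_; _,_)
open import Data.Vec.Functional using (Vector; removeAt)
open import Function using (_∘_)
open import Relation.Binary.Definitions using (tri<; tri≈; tri>)
open import Relation.Binary.PropositionalEquality
open import Relation.Nullary using (yes; no)
import Algebra.Properties.CommutativeSemigroup as CommSemigroupProperties
open import Algebra.Properties.Semiring.Sum +-*-semiring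
  using (sum; sum-syntax; sum⁺-syntax; sum-cong-≗; sum-init-last; sum-remove; sum-replicate-zero;
         ∑-distrib-+; *-distribˡ-sum; *-distribʳ-sum)

open import Defs

module +-Comm = CommSemigroupProperties +-commutativeSemigroup
module *-Comm = CommSemigroupProperties *-commutativeSemigroup

[k+1]*[n+1]C[k+1]≡[n+1]*nCk : ∀ n k → suc k * (suc n C suc k) ≡ suc n * (n C k)
[k+1]*[n+1]C[k+1]≡[n+1]*nCk zero    zero    = refl
[k+1]*[n+1]C[k+1]≡[n+1]*nCk zero    (suc k) = *-zeroʳ (suc (suc k))
[k+1]*[n+1]C[k+1]≡[n+1]*nCk (suc n) zero    =
  trans (*-identityˡ _) (trans (nC1≡n (suc (suc n))) (sym (*-identityʳ _)))
[k+1]*[n+1]C[k+1]≡[n+1]*nCk (suc n) (suc k) = begin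
  suc (suc k) * (suc (suc n) C suc (suc k))
    ≡⟨ cong (suc (suc k) *_) (nCk+nC[k+1]≡[n+1]C[k+1] (suc n) (suc k)) ⟨
  suc (suc k) * (X + suc n C suc (suc k))
    ≡⟨ *-distribˡ-+ (suc (suc k)) X _ ⟩
  (X + suc k * X) + suc (suc k) * (suc n C suc (suc k))
    ≡⟨ cong₂ (λ a b → (X + a) + b) ([k+1]*[n+1]C[k+1]≡[n+1]*nCk n k)
                                   ([k+1]*[n+1]C[k+1]≡[n+1]*nCk n (suc k)) ⟩
  (X + suc n * (n C k)) + suc n * (n C suc k)
    ≡⟨ +-assoc X _ _ ⟩
  X + (suc n * (n C k) + suc n * (n C suc k))
    ≡⟨ cong (X +_) (*-distribˡ-+ (suc n) (n C k) _) ⟨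
  X + suc n * (n C k + n C suc k)
    ≡⟨ cong (λ y → X + suc n * y) (nCk+nC[k+1]≡[n+1]C[k+1] n k) ⟩
  suc (suc n) * X ∎
  where
  open ≡-Reasoning
  X = suc n C suc k

[k+1]*nC[k+1]≡[n∸k]*nCk : ∀ n k → suc k * (n C suc k) ≡ (n ∸ k) * (n C k)
[k+1]*nC[k+1]≡[n∸k]*nCk n k with k ≤? n
... | no k≰n
  rewrite k>n⇒nCk≡0 (m<n⇒m<1+n (≰⇒> k≰n)) | m≤n⇒m∸n≡0 (<⇒≤ (≰⇒> k≰n)) = *-zeroʳ (suc k)
... | yes k≤n = +-cancelʳ-≡ (suc k * (n C k)) _ _ (begin
  suc k * (n C suc k) + suc k * (n C k)    ≡⟨ +-comm _ (suc k * (n C k)) ⟩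
  suc k * (n C k) + suc k * (n C suc k)    ≡⟨ *-distribˡ-+ (suc k) (n C k) _ ⟨
  suc k * (n C k + n C suc k)              ≡⟨ cong (suc k *_) (nCk+nC[k+1]≡[n+1]C[k+1] n k) ⟩
  suc k * (suc n C suc k)                  ≡⟨ [k+1]*[n+1]C[k+1]≡[n+1]*nCk n k ⟩
  suc n * (n C k)                          ≡⟨ cong (λ m → suc m * (n C k)) (m+[n∸m]≡n k≤n) ⟨
  (suc k + (n ∸ k)) * (n C k)              ≡⟨ *-distribʳ-+ (n C k) (suc k) (n ∸ k) ⟩
  suc k * (n C k) + (n ∸ k) * (n C k)      ≡⟨ +-comm (suc k * (n C k)) _ ⟩
  (n ∸ k) * (n C k) + suc k * (n C k)      ∎)
  where open ≡-Reasoning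

[n+1]Ck≤[k+1]*nCk : ∀ {n k} → k ≤ n → suc n C k ≤ suc k * (n C k)
[n+1]Ck≤[k+1]*nCk {n} {zero}  _   = ≤-refl
[n+1]Ck≤[k+1]*nCk {n} {suc k} k<n = begin
  suc n C suc k                   ≡⟨ nCk+nC[k+1]≡[n+1]C[k+1] n k ⟨
  n C k + n C suc k               ≤⟨ +-monoˡ-≤ (n C suc k) (m≤n*m (n C k) (n ∸ k)) ⟩
  (n ∸ k) * (n C k) + n C suc k   ≡⟨ cong (_+ n C suc k) ([k+1]*nC[k+1]≡[n∸k]*nCk n k) ⟨
  suc k * (n C suc k) + n C suc k ≡⟨ +-comm (suc k * (n C suc k)) _ ⟩
  suc (suc k) * (n C suc k)       ∎
  where
  open ≤-Reasoning
  instance _ = >-nonZero (m<n⇒0<n∸m k<n)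

binomial-step : ∀ q {k m} → k ≤ m →
  suc k * ((q + (suc m ∸ k)) C suc m) + (m ∸ k) * ((q + (m ∸ k)) C suc m)
    ≡ suc q * ((q + (m ∸ k)) C m)
binomial-step q {k} {m} k≤m = +-cancelʳ-≡ (r * X) _ _ (begin
  suc k * ((q + (suc m ∸ k)) C suc m) + r * Y + r * X
    ≡⟨ cong (λ z → suc k * (z C suc m) + r * Y + r * X) q+[1+m∸k]≡1+M ⟩
  suc k * (suc M C suc m) + r * Y + r * X
    ≡⟨ cong (λ z → suc k * z + r * Y + r * X) (nCk+nC[k+1]≡[n+1]C[k+1] M m) ⟨
  suc k * (X + Y) + r * Y + r * X    ≡⟨ regroup k r X Y ⟩
  suc (k + r) * (X + Y)              ≡⟨ cong (λ n → suc n * (X + Y)) (m+[n∸m]≡n k≤m) ⟩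
  suc m * (X + Y)                    ≡⟨ cong (suc m *_) (nCk+nC[k+1]≡[n+1]C[k+1] M m) ⟩
  suc m * (suc M C suc m)            ≡⟨ [k+1]*[n+1]C[k+1]≡[n+1]*nCk M m ⟩
  suc M * X                          ≡⟨ *-distribʳ-+ X (suc q) r ⟩
  suc q * X + r * X                  ∎)
  where
  open ≡-Reasoning
  r = m ∸ k
  M = q + r
  X = M C m
  Y = M C suc m
  q+[1+m∸k]≡1+M : q + (suc m ∸ k) ≡ suc M
  q+[1+m∸k]≡1+M = trans (cong (q +_) (+-∸-assoc 1 k≤m)) (+-suc q r)
  regroup : ∀ k r X Y → suc k * (X + Y) + r * Y + r * X ≡ suc (k + r) * (X + Y)
  regroup = solve-∀

δ : ℕ → ℕ → ℕ
δ k a = if a ≡ᵇ k then 1 else 0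

δ-diag : ∀ k → δ k k ≡ 1
δ-diag zero    = refl
δ-diag (suc k) = δ-diag k

δ-pick : ∀ (f : ℕ → ℕ) k a → f a * δ k a ≡ f k * δ k a
δ-pick f zero    zero    = refl
δ-pick f zero    (suc a) = trans (*-zeroʳ (f (suc a))) (sym (*-zeroʳ (f zero)))
δ-pick f (suc k) zero    = trans (*-zeroʳ (f zero)) (sym (*-zeroʳ (f (suc k))))
δ-pick f (suc k) (suc a) = δ-pick (f ∘ suc) k a

eulerian′ : ℕ → ℕ → ℕ
eulerian′ zero    zero    = 1
eulerian′ zero    (suc k) = 0
eulerian′ (suc n) zero    = eulerian′ n zero
eulerian′ (suc n) (suc k) = suc (suc k) * eulerian′ n (suc k) + (n ∸ k) * eulerian′ n k

eulerian′-zero : ∀ n → eulerian′ n 0 ≡ 1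
eulerian′-zero zero    = refl
eulerian′-zero (suc n) = eulerian′-zero n

k>n⇒eulerian′nk≡0 : ∀ {n k} → k > n → eulerian′ n k ≡ 0
k>n⇒eulerian′nk≡0 {zero}  {suc k} _         = refl
k>n⇒eulerian′nk≡0 {suc n} {suc k} (s<s k>n)
  rewrite k>n⇒eulerian′nk≡0 (m<n⇒m<1+n k>n) | k>n⇒eulerian′nk≡0 k>n
  = cong₂ _+_ (*-zeroʳ (suc (suc k))) (*-zeroʳ (n ∸ k))

<⇒<ᵇ≡true : ∀ {m n} → m < n → (m <ᵇ n) ≡ true
<⇒<ᵇ≡true z<s               = refl
<⇒<ᵇ≡true (s<s m<n@(s≤s _)) = <⇒<ᵇ≡true m<n

≤⇒<ᵇ≡false : ∀ {m n} → n ≤ m → (m <ᵇ n) ≡ false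
≤⇒<ᵇ≡false z≤n       = refl
≤⇒<ᵇ≡false (s≤s n≤m) = ≤⇒<ᵇ≡false n≤m

descents : List ℕ → ℕ
descents []           = 0
descents (x ∷ [])     = 0
descents (x ∷ y ∷ ys) = (if x <ᵇ y then 0 else 1) + descents (y ∷ ys)

ascents+descents≡length : ∀ y ys → ascents (y ∷ ys) + descents (y ∷ ys) ≡ length ys
ascents+descents≡length y []       = refl
ascents+descents≡length y (z ∷ zs) with y <ᵇ z
... | true  = cong suc (ascents+descents≡length z zs)
... | false = trans (+-suc (ascents (z ∷ zs)) _) (cong suc (ascents+descents≡length z zs))

ascentSum : (ℕ → ℕ) → List (List ℕ) → ℕ
ascentSum f = List.sum ∘ map (f ∘ ascents)

ascentSum-++ : ∀ f L L′ → ascentSum f (L ++ L′) ≡ ascentSum f L + ascentSum f L′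
ascentSum-++ f L L′ =
  trans (cong List.sum (map-++ (f ∘ ascents) L L′)) (sum-++ (map (f ∘ ascents) L) _)

ascentSum-cong : ∀ {f g} → (∀ a → f a ≡ g a) → ∀ L → ascentSum f L ≡ ascentSum g L
ascentSum-cong f≗g L = cong List.sum (map-cong (f≗g ∘ ascents) L)

ascentSum-linear : ∀ c d f g L →
  ascentSum (λ a → c * f a + d * g a) L ≡ c * ascentSum f L + d * ascentSum g L
ascentSum-linear c d f g []      = sym (cong₂ _+_ (*-zeroʳ c) (*-zeroʳ d))
ascentSum-linear c d f g (w ∷ L) =
  trans (cong (c * f a + d * g a +_) (ascentSum-linear c d f g L))
        (regroup c d (f a) (g a) (ascentSum f L) (ascentSum g L))
  where
  a = ascents w
  regroup : ∀ c d x y X Y → c * x + d * y + (c * X + d * Y) ≡ c * (x + X) + d * (y + Y)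
  regroup = solve-∀

ascentSum-shift : ∀ f y z I →
  ascentSum f (map (y ∷_) (map (z ∷_) I))
    ≡ ascentSum (f ∘ ((if y <ᵇ z then 1 else 0) +_)) (map (z ∷_) I)
ascentSum-shift f y z []      = refl
ascentSum-shift f y z (u ∷ I) = cong (f (ascents (y ∷ z ∷ u)) +_) (ascentSum-shift f y z I)

-- Stated for an arbitrary weight f because prepending y shifts every ascent count of the
-- recursive call by the same amount, which is absorbed into f.
ascentSum-insertions-under : ∀ f {x y ys} → x < y → All (x <_) ys →
  let a = ascents (y ∷ ys) in
  ascentSum f (map (y ∷_) (insertions x ys)) ≡ suc a * f a + descents (y ∷ ys) * f (suc a)
ascentSum-insertions-under f {x} {y} {[]} x<y []
  rewrite ≤⇒<ᵇ≡false (<⇒≤ x<y) = sym (+-identityʳ (f 0 + 0))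
ascentSum-insertions-under f {x} {y} {z ∷ zs} x<y (x<z ∷ x<zs)
  rewrite ≤⇒<ᵇ≡false (<⇒≤ x<y) | <⇒<ᵇ≡true x<z
        | ascentSum-shift f y z (insertions x zs)
        | ascentSum-insertions-under (f ∘ ((if y <ᵇ z then 1 else 0) +_)) x<z x<zs
  with y <ᵇ z
... | true  = sym (+-assoc (f (suc a)) _ _)
  where a = ascents (z ∷ zs)
... | false = +-Comm.x∙yz≈y∙xz (f (suc a)) (suc a * f a) _
  where a = ascents (z ∷ zs)

ascentSum-insertions : ∀ f {x w} → All (x <_) w →
  let a = ascents w in
  ascentSum f (insertions x w) ≡ suc a * f a + (length w ∸ a) * f (suc a)
ascentSum-insertions f {x} {[]}     []           = sym (+-identityʳ (f 0 + 0))
ascentSum-insertions f {x} {y ∷ ys} (x<y ∷ x<ys) rewrite <⇒<ᵇ≡true x<y = begin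
  f (suc a) + ascentSum f (map (y ∷_) (insertions x ys))
    ≡⟨ cong (f (suc a) +_) (ascentSum-insertions-under f x<y x<ys) ⟩
  f (suc a) + (suc a * f a + d * f (suc a))
    ≡⟨ +-Comm.x∙yz≈y∙xz (f (suc a)) (suc a * f a) _ ⟩
  suc a * f a + suc d * f (suc a)
    ≡⟨ cong (λ n → suc a * f a + n * f (suc a)) 1+d≡1+length∸a ⟩
  suc a * f a + (suc (length ys) ∸ a) * f (suc a) ∎
  where
  open ≡-Reasoning
  a = ascents (y ∷ ys)
  d = descents (y ∷ ys)
  1+d≡1+length∸a : suc d ≡ suc (length ys) ∸ a
  1+d≡1+length∸a = begin
    suc d               ≡⟨ m+n∸m≡n a (suc d) ⟨
    a + suc d ∸ a       ≡⟨ cong (_∸ a) (+-suc a d) ⟩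
    suc (a + d) ∸ a     ≡⟨ cong (λ n → suc n ∸ a) (ascents+descents≡length y ys) ⟩
    suc (length ys) ∸ a ∎

ascentSum-concatMap-insertions : ∀ f {x m} L → All (λ w → length w ≡ m × All (x <_) w) L →
  ascentSum f (concatMap (insertions x) L)
    ≡ ascentSum (λ a → suc a * f a + (m ∸ a) * f (suc a)) L
ascentSum-concatMap-insertions f []      []                   = refl
ascentSum-concatMap-insertions f (w ∷ L) ((refl , x<w) ∷ invL) =
  trans (ascentSum-++ f (insertions _ w) _)
        (cong₂ _+_ (ascentSum-insertions f x<w) (ascentSum-concatMap-insertions f L invL))

insertions-invariant : ∀ {P : ℕ → Set} {x w} → P x → All P w →
  All (λ v → length v ≡ suc (length w) × All P v) (insertions x w)
insertions-invariant {w = []}     px []         = (refl , px ∷ []) ∷ []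
insertions-invariant {w = y ∷ ys} px (py ∷ pys) =
  (refl , px ∷ py ∷ pys)
    ∷ map⁺ (All.map (λ (e , pv) → cong suc e , py ∷ pv) (insertions-invariant px pys))

perms-invariant : ∀ {P : ℕ → Set} {xs} → All P xs →
  All (λ w → length w ≡ length xs × All P w) (perms xs)
perms-invariant []         = (refl , []) ∷ []
perms-invariant (px ∷ pxs) = concat⁺ (map⁺ (All.map
  (λ (e , pw) → All.map (λ (e′ , pv) → trans e′ (cong suc e) , pv) (insertions-invariant px pw))
  (perms-invariant pxs)))

ascentSum-δ-perms : ∀ {xs} → AllPairs _<_ xs → ∀ k →
  ascentSum (δ k) (perms xs) ≡ eulerian′ (length xs) k
ascentSum-δ-perms []     zero    = refl
ascentSum-δ-perms []     (suc k) = refl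
ascentSum-δ-perms {x ∷ xs} (x<xs ∷ sorted) k
  rewrite ascentSum-concatMap-insertions (δ k) (perms xs) (perms-invariant x<xs) = recurrence k
  where
  m = length xs
  recurrence : ∀ k →
    ascentSum (λ a → suc a * δ k a + (m ∸ a) * δ k (suc a)) (perms xs) ≡ eulerian′ (suc m) k
  recurrence zero = begin
    ascentSum (λ a → suc a * δ 0 a + (m ∸ a) * 0) (perms xs)
      ≡⟨ ascentSum-cong (λ a → cong₂ _+_ (δ-pick suc 0 a) (*-zeroʳ (m ∸ a))) (perms xs) ⟩
    ascentSum (λ a → 1 * δ 0 a + 0) (perms xs)
      ≡⟨ ascentSum-cong (λ a → +-identityʳ (1 * δ 0 a)) (perms xs) ⟩
    ascentSum (λ a → δ 0 a + 0) (perms xs)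
      ≡⟨ ascentSum-cong (λ a → +-identityʳ (δ 0 a)) (perms xs) ⟩
    ascentSum (δ 0) (perms xs)
      ≡⟨ ascentSum-δ-perms sorted 0 ⟩
    eulerian′ m 0 ∎
    where open ≡-Reasoning
  recurrence (suc j) = begin
    ascentSum (λ a → suc a * δ (suc j) a + (m ∸ a) * δ j a) (perms xs)
      ≡⟨ ascentSum-cong (λ a → cong₂ _+_ (δ-pick suc (suc j) a) (δ-pick (m ∸_) j a)) (perms xs) ⟩
    ascentSum (λ a → suc (suc j) * δ (suc j) a + (m ∸ j) * δ j a) (perms xs)
      ≡⟨ ascentSum-linear (suc (suc j)) (m ∸ j) (δ (suc j)) (δ j) (perms xs) ⟩
    suc (suc j) * ascentSum (δ (suc j)) (perms xs) + (m ∸ j) * ascentSum (δ j) (perms xs)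
      ≡⟨ cong₂ (λ e e′ → suc (suc j) * e + (m ∸ j) * e′)
               (ascentSum-δ-perms sorted (suc j)) (ascentSum-δ-perms sorted j) ⟩
    eulerian′ (suc m) (suc j) ∎
    where open ≡-Reasoning

length-filterᵇ : ∀ {A : Set} (p : A → Bool) xs →
  length (filterᵇ p xs) ≡ List.sum (map (λ x → if p x then 1 else 0) xs)
length-filterᵇ p []       = refl
length-filterᵇ p (x ∷ xs) with p x
... | true  = cong suc (length-filterᵇ p xs)
... | false = length-filterᵇ p xs

eulerian≡eulerian′ : ∀ n k → eulerian n k ≡ eulerian′ n k
eulerian≡eulerian′ n k = begin
  eulerian n k                             ≡⟨ length-filterᵇ _ (permutationsOf n) ⟩
  ascentSum (δ k) (permutationsOf n)       ≡⟨ ascentSum-δ-perms sorted-map-suc-upTo k ⟩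
  eulerian′ (length (map suc (upTo n))) k  ≡⟨ cong (λ m → eulerian′ m k) length-map-suc-upTo ⟩
  eulerian′ n k                            ∎
  where
  open ≡-Reasoning
  sorted-map-suc-upTo : AllPairs _<_ (map suc (upTo n))
  sorted-map-suc-upTo = AllPairs.map⁺ (AllPairs.applyUpTo⁺₁ (λ i → i) n (λ i<j _ → s<s i<j))
  length-map-suc-upTo : length (map suc (upTo n)) ≡ n
  length-map-suc-upTo = trans (length-map suc (upTo n)) (length-upTo n)

sum-mono-≤ : ∀ {n} {s t : Vector ℕ n} → (∀ i → s i ≤ t i) → sum s ≤ sum t
sum-mono-≤ {zero}  s≤t = z≤n
sum-mono-≤ {suc n} s≤t = +-mono-≤ (s≤t Fin.zero) (sum-mono-≤ (s≤t ∘ Fin.suc))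

∑δ≤1 : ∀ n k → ∑[ i < n ] δ k (toℕ i) ≤ 1
∑δ≤1 zero    k       = z≤n
∑δ≤1 (suc n) zero    = ≤-reflexive (cong suc (sum-replicate-zero n))
∑δ≤1 (suc n) (suc k) = ∑δ≤1 n k

worpitzkyTerm : ℕ → ℕ → ℕ → ℕ
worpitzkyTerm n q k = eulerian′ n k * ((q + (n ∸ k)) C n)

worpitzky : ∀ n q → ∑[ k ≤ n ] worpitzkyTerm n q (toℕ k) ≡ suc q ^ n
worpitzky zero    q = refl
worpitzky (suc m) q = begin
  t 0 + ∑[ j ≤ m ] t (suc (toℕ j))
    ≡⟨ cong₂ _+_ t-zero (sum-cong-≗ {suc m} (t-suc ∘ toℕ)) ⟩
  A 0 + ∑[ j ≤ m ] (A (suc (toℕ j)) + B (toℕ j))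
    ≡⟨ cong (A 0 +_) (∑-distrib-+ {suc m} (A ∘ suc ∘ toℕ) (B ∘ toℕ)) ⟩
  A 0 + (∑[ j ≤ m ] A (suc (toℕ j)) + ΣB)
    ≡⟨ +-assoc (A 0) _ _ ⟨
  ∑[ k ≤ suc m ] A (toℕ k) + ΣB
    ≡⟨ cong (_+ ΣB) (sum-init-last {suc m} (A ∘ toℕ)) ⟩
  (∑[ k ≤ m ] A (toℕ (Fin.inject₁ k)) + A (toℕ (Fin.fromℕ (suc m)))) + ΣB
    ≡⟨ cong₂ (λ a b → a + b + ΣB) (sum-cong-≗ {suc m} (cong A ∘ toℕ-inject₁))
                                  (trans (cong A (toℕ-fromℕ (suc m))) A-last) ⟩
  (∑[ k ≤ m ] A (toℕ k) + 0) + ΣB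
    ≡⟨ cong (_+ ΣB) (+-identityʳ (∑[ k ≤ m ] A (toℕ k))) ⟩
  ∑[ k ≤ m ] A (toℕ k) + ΣB
    ≡⟨ ∑-distrib-+ {suc m} (A ∘ toℕ) (B ∘ toℕ) ⟨
  ∑[ k ≤ m ] (A (toℕ k) + B (toℕ k))
    ≡⟨ sum-cong-≗ {suc m} (λ k → A+B (s≤s⁻¹ (toℕ<n k))) ⟩
  ∑[ k ≤ m ] (suc q * worpitzkyTerm m q (toℕ k))
    ≡⟨ *-distribˡ-sum {suc m} (suc q) (worpitzkyTerm m q ∘ toℕ) ⟨
  suc q * ∑[ k ≤ m ] worpitzkyTerm m q (toℕ k)
    ≡⟨ cong (suc q *_) (worpitzky m q) ⟩
  suc q * suc q ^ m ∎
  where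
  open ≡-Reasoning
  t = worpitzkyTerm (suc m) q
  A B : ℕ → ℕ
  A k = suc k * eulerian′ m k * ((q + (suc m ∸ k)) C suc m)
  B k = (m ∸ k) * eulerian′ m k * ((q + (m ∸ k)) C suc m)
  ΣB = ∑[ j ≤ m ] B (toℕ j)
  t-zero : t 0 ≡ A 0
  t-zero = cong (_* ((q + suc m) C suc m)) (sym (*-identityˡ (eulerian′ m 0)))
  t-suc : ∀ j → t (suc j) ≡ A (suc j) + B j
  t-suc j = *-distribʳ-+ ((q + (m ∸ j)) C suc m) (suc (suc j) * eulerian′ m (suc j)) _
  A-last : A (suc m) ≡ 0
  A-last = begin
    suc (suc m) * eulerian′ m (suc m) * ((q + (m ∸ m)) C suc m)
      ≡⟨ cong (λ e → suc (suc m) * e * ((q + (m ∸ m)) C suc m)) (k>n⇒eulerian′nk≡0 (n<1+n m)) ⟩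
    suc (suc m) * 0 * ((q + (m ∸ m)) C suc m)
      ≡⟨ cong (_* ((q + (m ∸ m)) C suc m)) (*-zeroʳ (suc (suc m))) ⟩
    0 ∎
  factor : ∀ a b e x y → a * e * x + b * e * y ≡ e * (a * x + b * y)
  factor = solve-∀
  A+B : ∀ {k} → k ≤ m → A k + B k ≡ suc q * worpitzkyTerm m q k
  A+B {k} k≤m = begin
    A k + B k
      ≡⟨ factor (suc k) (m ∸ k) (eulerian′ m k) _ _ ⟩
    eulerian′ m k * (suc k * ((q + (suc m ∸ k)) C suc m) + (m ∸ k) * ((q + (m ∸ k)) C suc m))
      ≡⟨ cong (eulerian′ m k *_) (binomial-step q k≤m) ⟩
    eulerian′ m k * (suc q * ((q + (m ∸ k)) C m))
      ≡⟨ *-Comm.x∙yz≈y∙xz (eulerian′ m k) (suc q) _ ⟩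
    suc q * worpitzkyTerm m q k ∎

eulerian′≤[1+q]^n : ∀ n q → eulerian′ n q ≤ suc q ^ n
eulerian′≤[1+q]^n n q with q ≤? n
... | no q≰n  = subst (_≤ suc q ^ n) (sym (k>n⇒eulerian′nk≡0 (≰⇒> q≰n))) z≤n
... | yes q≤n = begin
  eulerian′ n q                         ≡⟨ *-identityʳ (eulerian′ n q) ⟨
  eulerian′ n q * 1                     ≡⟨ cong (eulerian′ n q *_) (nCn≡1 n) ⟨
  eulerian′ n q * (n C n)               ≡⟨ cong (λ m → eulerian′ n q * (m C n)) (m+[n∸m]≡n q≤n) ⟨
  worpitzkyTerm n q q                   ≡⟨ cong (worpitzkyTerm n q) (toℕ-fromℕ< (s≤s q≤n)) ⟨
  t i                                   ≤⟨ m≤m+n (t i) _ ⟩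
  t i + sum (removeAt t i)              ≡⟨ sum-remove {n} t ⟨
  ∑[ k ≤ n ] worpitzkyTerm n q (toℕ k)  ≡⟨ worpitzky n q ⟩
  suc q ^ n                             ∎
  where
  open ≤-Reasoning
  t : Vector ℕ (suc n)
  t = worpitzkyTerm n q ∘ toℕ
  i = fromℕ< (s≤s q≤n)

worpitzkyTerm-suc≤ : ∀ n p k → k ≤ n →
  worpitzkyTerm n (suc p) k ≤ δ (suc p) k * eulerian′ n (suc p) + suc n * worpitzkyTerm n p k
worpitzkyTerm-suc≤ n p k k≤n with <-cmp k (suc p)
... | tri< k≤p _ _ = ≤-trans (begin
  eulerian′ n k * (suc (p + r) C n)        ≤⟨ *-monoʳ-≤ (eulerian′ n k) ([n+1]Ck≤[k+1]*nCk n≤p+r) ⟩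
  eulerian′ n k * (suc n * ((p + r) C n))  ≡⟨ *-Comm.x∙yz≈y∙xz (eulerian′ n k) (suc n) _ ⟩
  suc n * worpitzkyTerm n p k              ∎) (m≤n+m _ (δ (suc p) k * eulerian′ n (suc p)))
  where
  open ≤-Reasoning
  r = n ∸ k
  n≤p+r : n ≤ p + r
  n≤p+r = ≤-trans (≤-reflexive (sym (m+[n∸m]≡n k≤n))) (+-monoˡ-≤ r (s≤s⁻¹ k≤p))
... | tri≈ _ refl _ = ≤-trans (≤-reflexive (begin-equality
  eulerian′ n k * ((k + (n ∸ k)) C n)  ≡⟨ cong (λ m → eulerian′ n k * (m C n)) (m+[n∸m]≡n k≤n) ⟩
  eulerian′ n k * (n C n)              ≡⟨ cong (eulerian′ n k *_) (nCn≡1 n) ⟩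
  eulerian′ n k * 1                    ≡⟨ *-comm (eulerian′ n k) 1 ⟩
  1 * eulerian′ n k                    ≡⟨ cong (_* eulerian′ n k) (δ-diag k) ⟨
  δ k k * eulerian′ n k                ∎)) (m≤m+n _ _)
  where open ≤-Reasoning
... | tri> _ _ k>p+1 = ≤-trans (≤-reflexive vanishes) z≤n
  where
  1+p+r<n : suc p + (n ∸ k) < n
  1+p+r<n = ≤-trans (+-monoˡ-≤ (n ∸ k) k>p+1) (≤-reflexive (m+[n∸m]≡n k≤n))
  vanishes : worpitzkyTerm n (suc p) k ≡ 0
  vanishes = trans (cong (eulerian′ n k *_) (k>n⇒nCk≡0 1+p+r<n)) (*-zeroʳ (eulerian′ n k))

[1+q]^n≤eulerian′+[n+1]q^n : ∀ n q → suc q ^ n ≤ eulerian′ n q + suc n * q ^ n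
[1+q]^n≤eulerian′+[n+1]q^n n zero rewrite eulerian′-zero n | ^-zeroˡ n = m≤m+n 1 _
[1+q]^n≤eulerian′+[n+1]q^n n (suc p) = begin
  suc (suc p) ^ n
    ≡⟨ worpitzky n (suc p) ⟨
  ∑[ k ≤ n ] worpitzkyTerm n (suc p) (toℕ k)
    ≤⟨ sum-mono-≤ (λ k → worpitzkyTerm-suc≤ n p (toℕ k) (s≤s⁻¹ (toℕ<n k))) ⟩
  ∑[ k ≤ n ] (δ (suc p) (toℕ k) * E + suc n * worpitzkyTerm n p (toℕ k))
    ≡⟨ ∑-distrib-+ {suc n} (λ k → δ (suc p) (toℕ k) * E) (λ k → suc n * worpitzkyTerm n p (toℕ k)) ⟩
  ∑[ k ≤ n ] (δ (suc p) (toℕ k) * E) + ∑[ k ≤ n ] (suc n * worpitzkyTerm n p (toℕ k))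
    ≡⟨ cong₂ _+_ (*-distribʳ-sum {suc n} E (δ (suc p) ∘ toℕ))
                 (*-distribˡ-sum {suc n} (suc n) (worpitzkyTerm n p ∘ toℕ)) ⟨
  ∑[ k ≤ n ] δ (suc p) (toℕ k) * E + suc n * ∑[ k ≤ n ] worpitzkyTerm n p (toℕ k)
    ≤⟨ +-monoˡ-≤ _ (*-monoˡ-≤ E (∑δ≤1 (suc n) (suc p))) ⟩
  1 * E + suc n * ∑[ k ≤ n ] worpitzkyTerm n p (toℕ k)
    ≡⟨ cong₂ _+_ (*-identityˡ E) (cong (suc n *_) (worpitzky n p)) ⟩
  E + suc n * suc p ^ n ∎
  where
  open ≤-Reasoning
  E = eulerian′ n (suc p)

-- The bounds hold for n = 0 as well.
mainTheorem19 : (n q : ℕ) → 1 ≤ n →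
    ((suc q) ^ n ≤ eulerian n q + (n + 1) * q ^ n) × (eulerian n q ≤ (suc q) ^ n)
mainTheorem19 n q _ rewrite eulerian≡eulerian′ n q | +-comm n 1 =
  [1+q]^n≤eulerian′+[n+1]q^n n q , eulerian′≤[1+q]^n n q
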